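{- Let $n \geq 1$ and let $C$ be the connected component of the cyclic shift graph $K(\mathsf{sylv}_n)$ consisting of the standard elements of $\mathsf{sylv}_n$ with $n$ nodes (i.e. the elements represented by standard words of length $n$, such as $12\cdots n$). Then $C$ has diameter at least $n-1$.
   Context: $\mathcal{A}_n = \{1<2<\cdots<n\}$. The sylvester monoid of rank $n$, $\mathsf{sylv}_n$, is the monoid presented by $\langle \mathcal{A}_n \mid (cavb, acvb)\text{ for all } a \leq b < c \text{ in } \mathcal{A}_n,\ v \in \mathcal{A}_n^*\rangle$; its elements correspond to right strict binary search trees (trees obtained by inserting the symbols of a word right to left as leaves, where each node's label is $\geq$ all labels in its left subtree and $<$ all labels in its right subtree). A word is standard if it contains each symbol of $\{1,\ldots,|u|\}$ exactly once; an element is standard if it is represented by a standard word (equivalently its tree has exactly one node labelled by each of $1,\ldots,k$). In a monoid $M$, $s \sim t$ iff there exist $x,y\in M$ with $s = xy$, $t = yx$. The cyclic shift graph $K(M)$ is the undirected graph with vertex set $M$ and an edge between $s$ and $t$ iff $s \sim t$. The diameter of a connected component is the maximum graph distance between two of its vertices. (It is known from earlier work that the standard elements with $n$ nodes form a single connected component.) -}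

module Defs where

open import Data.Nat using (ℕ; zero; suc)
open import Data.Fin using (Fin; _≤_; _<_)
open import Data.List using (List; []; _∷_; _++_; allFin)
open import Data.List.Relation.Binary.Permutation.Propositional using (_↭_)
open import Data.Product using (Σ; _×_)

-- The alphabet 𝒜ₙ = {1 < 2 < ... < n} is modelled as Fin n (with its usual order);
-- words over 𝒜ₙ are lists.
Word : ℕ → Set
Word n = List (Fin n)

data SylvStep {n : ℕ} : Word n → Word n → Set where
  rel : (x y v : Word n) (a b c : Fin n) → a ≤ b → b < c →
        SylvStep (x ++ (c ∷ a ∷ v ++ b ∷ []) ++ y) (x ++ (a ∷ c ∷ v ++ b ∷ []) ++ y)

-- The sylvester congruence: the equivalence closure of SylvStep
-- (it is automatically compatible with concatenation since steps occur in any context).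
-- Two words are equal in sylv_n iff they are related by _≈s_.
data _≈s_ {n : ℕ} : Word n → Word n → Set where
  ≈-refl  : ∀ {u} → u ≈s u
  ≈-fwd   : ∀ {u v w} → SylvStep u v → v ≈s w → u ≈s w
  ≈-bwd   : ∀ {u v w} → SylvStep v u → v ≈s w → u ≈s w

Standard : {n : ℕ} → Word n → Set
Standard {n} w = w ↭ allFin n

Edge : {n : ℕ} → Word n → Word n → Set
Edge {n} s t = Σ (Word n) λ x → Σ (Word n) λ y → ((x ++ y) ≈s s) × ((y ++ x) ≈s t)

data Walk {n : ℕ} : ℕ → Word n → Word n → Set where
  here : ∀ {s t} → s ≈s t → Walk zero s t
  step : ∀ {k s r t} → Edge s r → Walk k r t → Walk (suc k) s t

-- For a word w over {0,...,n-1} (letters read as naturals) let asc w be the number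
-- of i < n - 1 such that i occurs to the left of i + 1 in w.
--   * On words without repeated letters, asc is constant on sylvester classes: a defining
--     relation cavb = acvb (a ≤ b < c) with a ≠ b has a < b < c, so it swaps two adjacent
--     letters whose values are not consecutive, and asc only sees the relative order of
--     consecutive values.
--   * Conjugation xy ↦ yx of a standard word changes asc by at most one: only the pairs
--     (i, i+1) split between x and y change their order, and as i runs upwards the pairs
--     leaving x and those entering x alternate, so their numbers differ by at most one.
-- Hence every edge of K(sylv_n) between standard elements changes asc by at most one,
-- while asc (0 1 ... n-1) = n - 1 and asc (n-1 ... 1 0) = 0, so any walk between these two
-- standard words has length at least n - 1.

module Submission where

open import Defs
open import Data.Bool using (Bool; true; false; not; _∧_; _∨_)
open import Data.Bool.Properties using (∨-assoc; ∨-identityʳ; ∨-zeroʳ; ∧-zeroʳ)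
open import Data.Bool.Solver using (module ∨-∧-Solver)
open import Data.Empty using (⊥-elim)
open import Data.Fin using (toℕ)
open import Data.Fin.Properties using (toℕ-injective; toℕ-fromℕ<)
open import Data.List using (List; []; _∷_; _++_; map; reverse; allFin)
open import Data.List.Properties using (map-++; reverse-map; unfold-reverse)
open import Data.List.Membership.Propositional using (_∈_; _∉_)
open import Data.List.Membership.Propositional.Properties
  using (∈-++⁻; ∈-++⁺ˡ; ∈-++⁺ʳ; ∈-map⁺; ∈-allFin)
open import Data.List.Relation.Binary.Permutation.Propositional
  using (_↭_; ↭-refl; ↭-sym; ↭-trans; swap; ↭⇒↭ₛ)
open import Data.List.Relation.Binary.Permutation.Propositional.Properties
  using (++⁺ˡ; ++⁺ʳ; ++-comm; ↭-reverse; ∈-resp-↭)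
import Data.List.Relation.Binary.Permutation.Setoid.Properties as PermutationSetoid
open import Data.List.Relation.Unary.Any using (here; there)
open import Data.List.Relation.Unary.All as All using ()
open import Data.List.Relation.Unary.All.Properties using (++⁻ʳ)
open import Data.List.Relation.Unary.AllPairs using (AllPairs; _∷_)
import Data.List.Relation.Unary.AllPairs.Properties as AllPairs
open import Data.List.Relation.Unary.Unique.Propositional using (Unique)
import Data.List.Relation.Unary.Unique.Propositional.Properties as Unique
open import Data.Nat using (ℕ; zero; suc; _+_; _<_; _≤_; _∸_; z≤n; s≤s)
import Data.Nat as ℕ
open import Data.Nat.Properties
  using (n<1+n; m<n⇒m<1+n; n≤1+n; <⇒≤; ≤-refl; <-trans; <-asym; <-irrefl; <⇒≱; ≤∧≢⇒<;
         +-comm; +-assoc; +-identityʳ; m≤m+n; +-monoˡ-≤; +-monoʳ-≤; +-cancelʳ-≤;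
         +-commutativeSemigroup; module ≤-Reasoning)
open import Algebra.Properties.CommutativeSemigroup +-commutativeSemigroup using (interchange)
open import Data.Product using (Σ; _×_; _,_)
open import Data.Sum as Sum using (_⊎_; inj₁; inj₂)
open import Level using (Level)
open import Relation.Binary.Definitions using (DecidableEquality)
open import Relation.Binary.PropositionalEquality
open import Relation.Nullary using (¬_; yes; no; does)
open import Relation.Nullary.Decidable using (dec-true)

bit : Bool → ℕ
bit true  = 1
bit false = 0

count : ℕ → (ℕ → Bool) → ℕ
count zero    P = 0
count (suc k) P = bit (P k) + count k P

count-cong : ∀ k {P Q : ℕ → Bool} → (∀ i → i < k → P i ≡ Q i) → count k P ≡ count k Q
count-cong zero    _   = refl
count-cong (suc k) P≡Q =
  cong₂ _+_ (cong bit (P≡Q k (n<1+n k))) (count-cong k (λ i i<k → P≡Q i (m<n⇒m<1+n i<k)))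

count-all : ∀ k {P : ℕ → Bool} → (∀ i → i < k → P i ≡ true) → count k P ≡ k
count-all zero    _     = refl
count-all (suc k) all-P rewrite all-P k (n<1+n k) =
  cong suc (count-all k (λ i i<k → all-P i (m<n⇒m<1+n i<k)))

count-none : ∀ k {P : ℕ → Bool} → (∀ i → i < k → P i ≡ false) → count k P ≡ 0
count-none zero    _      = refl
count-none (suc k) none-P rewrite none-P k (n<1+n k) =
  count-none k (λ i i<k → none-P i (m<n⇒m<1+n i<k))

count-exchange : ∀ k {P Q R S : ℕ → Bool} →
  (∀ i → i < k → bit (P i) + bit (Q i) ≡ bit (R i) + bit (S i)) →
  count k P + count k Q ≡ count k R + count k S
count-exchange zero    _     = refl
count-exchange (suc k) {P} {Q} {R} {S} local = begin
    (bit (P k) + count k P) + (bit (Q k) + count k Q)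
      ≡⟨ interchange (bit (P k)) (count k P) (bit (Q k)) (count k Q) ⟩
    (bit (P k) + bit (Q k)) + (count k P + count k Q)
      ≡⟨ cong₂ _+_ (local k (n<1+n k)) (count-exchange k (λ i i<k → local i (m<n⇒m<1+n i<k))) ⟩
    (bit (R k) + bit (S k)) + (count k R + count k S)
      ≡⟨ interchange (bit (R k)) (bit (S k)) (count k R) (count k S) ⟩
    (bit (R k) + count k R) + (bit (S k) + count k S) ∎
  where open ≡-Reasoning

-- Switches of a Boolean sequence f: an entry at i means f i = false, f (i+1) = true,
-- an exit means f i = true, f (i+1) = false.  Entries and exits alternate.
module Switches (f : ℕ → Bool) where

  entries : ℕ → ℕ
  entries k = count k (λ i → not (f i) ∧ f (suc i))

  exits : ℕ → ℕ
  exits k = count k (λ i → f i ∧ not (f (suc i)))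

  switch : ∀ i → bit (f i ∧ not (f (suc i))) + bit (f (suc i))
               ≡ bit (not (f i) ∧ f (suc i)) + bit (f i)
  switch i with f i | f (suc i)
  ... | true  | true  = refl
  ... | true  | false = refl
  ... | false | true  = refl
  ... | false | false = refl

  -- Telescoping the local balance `switch`.
  exits-entries : ∀ k → exits k + bit (f k) ≡ entries k + bit (f 0)
  exits-entries zero    = refl
  exits-entries (suc k) = begin
      (out + exits k) + bit (f (suc k))   ≡⟨ +-assoc out (exits k) _ ⟩
      out + (exits k + bit (f (suc k)))   ≡⟨ cong (out +_) (+-comm (exits k) _) ⟩
      out + (bit (f (suc k)) + exits k)   ≡⟨ +-assoc out _ (exits k) ⟨
      (out + bit (f (suc k))) + exits k   ≡⟨ cong (_+ exits k) (switch k) ⟩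
      (into + bit (f k)) + exits k        ≡⟨ +-assoc into _ (exits k) ⟩
      into + (bit (f k) + exits k)        ≡⟨ cong (into +_) (+-comm (bit (f k)) (exits k)) ⟩
      into + (exits k + bit (f k))        ≡⟨ cong (into +_) (exits-entries k) ⟩
      into + (entries k + bit (f 0))      ≡⟨ +-assoc into (entries k) _ ⟨
      (into + entries k) + bit (f 0)      ∎
    where
      open ≡-Reasoning
      out  = bit (f k ∧ not (f (suc k)))
      into = bit (not (f k) ∧ f (suc k))

  exits≤entries+1 : ∀ k → exits k ≤ entries k + 1
  exits≤entries+1 k = begin
      exits k                 ≤⟨ m≤m+n (exits k) (bit (f k)) ⟩
      exits k + bit (f k)     ≡⟨ exits-entries k ⟩
      entries k + bit (f 0)   ≤⟨ +-monoʳ-≤ (entries k) (bit≤1 (f 0)) ⟩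
      entries k + 1           ∎
    where
      open ≤-Reasoning
      bit≤1 : ∀ b → bit b ≤ 1
      bit≤1 true  = ≤-refl
      bit≤1 false = z≤n

module Occurrences {a : Level} {A : Set a} (_≟_ : DecidableEquality A) where

  mem : A → List A → Bool
  mem q []      = false
  mem q (x ∷ w) = does (q ≟ x) ∨ mem q w

  precedes : A → A → List A → Bool
  precedes p q []      = false
  precedes p q (x ∷ w) = (does (p ≟ x) ∧ mem q w) ∨ precedes p q w

  mem-++ : ∀ q B C → mem q (B ++ C) ≡ mem q B ∨ mem q C
  mem-++ q []      C = refl
  mem-++ q (x ∷ B) C rewrite mem-++ q B C = sym (∨-assoc (does (q ≟ x)) (mem q B) (mem q C))

  mem-∈ : ∀ {q w} → q ∈ w → mem q w ≡ true
  mem-∈ {q}         (here refl)  rewrite dec-true (q ≟ q) refl = refl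
  mem-∈ {q} {x ∷ w} (there q∈w) rewrite mem-∈ q∈w = ∨-zeroʳ (does (q ≟ x))

  ∈-mem : ∀ {q} w → mem q w ≡ true → q ∈ w
  ∈-mem {q} (x ∷ w) h with q ≟ x
  ... | yes refl = here refl
  ... | no _     = there (∈-mem w h)

  mem-∉ : ∀ {q w} → q ∉ w → mem q w ≡ false
  mem-∉ {q} {w} q∉w with mem q w in q∈w
  ... | true  = ⊥-elim (q∉w (∈-mem w q∈w))
  ... | false = refl

  precedes-++ : ∀ p q B C →
    precedes p q (B ++ C) ≡ precedes p q B ∨ (mem p B ∧ mem q C) ∨ precedes p q C
  precedes-++ p q []      C = refl
  precedes-++ p q (x ∷ B) C rewrite mem-++ q B C | precedes-++ p q B C =
    solve 6 (λ d b c r m s → (d :* (b :+ c)) :+ (r :+ ((m :* c) :+ s))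
                          := ((d :* b) :+ r) :+ (((d :+ m) :* c) :+ s))
          refl (does (p ≟ x)) (mem q B) (mem q C) (precedes p q B) (mem p B) (precedes p q C)
    where open ∨-∧-Solver

  precedes-absentˡ : ∀ {p q} w → mem p w ≡ false → precedes p q w ≡ false
  precedes-absentˡ []          _ = refl
  precedes-absentˡ {p} (x ∷ w) h with p ≟ x
  ... | no _ = precedes-absentˡ w h

  precedes-absentʳ : ∀ {p q} w → mem q w ≡ false → precedes p q w ≡ false
  precedes-absentʳ []              _ = refl
  precedes-absentʳ {p} {q} (x ∷ w) h with q ≟ x
  ... | no _ rewrite h | ∧-zeroʳ (does (p ≟ x)) = precedes-absentʳ w h

  precedes-swap-head : ∀ p q a c S → ¬ (p ≡ a × q ≡ c) → ¬ (p ≡ c × q ≡ a) →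
    precedes p q (a ∷ c ∷ S) ≡ precedes p q (c ∷ a ∷ S)
  precedes-swap-head p q a c S ¬ac ¬ca = begin
      precedes p q (a ∷ c ∷ S)
        ≡⟨ solve 6 (λ pa qc pc qa m r → (pa :* (qc :+ m)) :+ ((pc :* m) :+ r)
                                     := (pa :* qc) :+ (((pa :* m) :+ (pc :* m)) :+ r))
                 refl (does (p ≟ a)) (does (q ≟ c)) (does (p ≟ c)) (does (q ≟ a)) (mem q S)
                 (precedes p q S) ⟩
      (does (p ≟ a) ∧ does (q ≟ c)) ∨ rest
        ≡⟨ cong (_∨ rest) (trans (not-both ¬ac) (sym (not-both ¬ca))) ⟩
      (does (p ≟ c) ∧ does (q ≟ a)) ∨ rest
        ≡⟨ solve 6 (λ pa qc pc qa m r → (pc :* qa) :+ (((pa :* m) :+ (pc :* m)) :+ r)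
                                     := (pc :* (qa :+ m)) :+ ((pa :* m) :+ r))
                 refl (does (p ≟ a)) (does (q ≟ c)) (does (p ≟ c)) (does (q ≟ a)) (mem q S)
                 (precedes p q S) ⟩
      precedes p q (c ∷ a ∷ S) ∎
    where
      open ≡-Reasoning
      open ∨-∧-Solver
      rest = ((does (p ≟ a) ∧ mem q S) ∨ (does (p ≟ c) ∧ mem q S)) ∨ precedes p q S
      not-both : ∀ {x y} → ¬ (p ≡ x × q ≡ y) → does (p ≟ x) ∧ does (q ≟ y) ≡ false
      not-both {x} {y} ¬pair with p ≟ x | q ≟ y
      ... | yes p≡x | yes q≡y = ⊥-elim (¬pair (p≡x , q≡y))
      ... | yes _   | no _    = refl
      ... | no _    | _       = refl

  mem-swap : ∀ q a c S → mem q (a ∷ c ∷ S) ≡ mem q (c ∷ a ∷ S)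
  mem-swap q a c S = solve 3 (λ qa qc m → qa :+ (qc :+ m) := qc :+ (qa :+ m)) refl
                       (does (q ≟ a)) (does (q ≟ c)) (mem q S)
    where open ∨-∧-Solver

  precedes-swap : ∀ p q P a c S → ¬ (p ≡ a × q ≡ c) → ¬ (p ≡ c × q ≡ a) →
    precedes p q (P ++ a ∷ c ∷ S) ≡ precedes p q (P ++ c ∷ a ∷ S)
  precedes-swap p q P a c S ¬ac ¬ca
    rewrite precedes-++ p q P (a ∷ c ∷ S) | precedes-++ p q P (c ∷ a ∷ S)
          | precedes-swap-head p q a c S ¬ac ¬ca | mem-swap q a c S
    = refl

  mem-reverse : ∀ q w → mem q (reverse w) ≡ mem q w
  mem-reverse q []      = refl
  mem-reverse q (x ∷ w)
    rewrite unfold-reverse x w | mem-++ q (reverse w) (x ∷ []) | mem-reverse q w =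
    solve 2 (λ m qx → m :+ (qx :+ con false) := qx :+ m) refl (mem q w) (does (q ≟ x))
    where open ∨-∧-Solver

  precedes-reverse : ∀ p q w → precedes p q (reverse w) ≡ precedes q p w
  precedes-reverse p q []      = refl
  precedes-reverse p q (x ∷ w)
    rewrite unfold-reverse x w | precedes-++ p q (reverse w) (x ∷ [])
          | precedes-reverse p q w | mem-reverse p w =
    solve 4 (λ r m qx px → r :+ ((m :* (qx :+ con false)) :+ ((px :* con false) :+ con false))
                          := (qx :* m) :+ r)
          refl (precedes q p w) (mem p w) (does (q ≟ x)) (does (p ≟ x))
    where open ∨-∧-Solver

  precedes-sorted : ∀ {ℓ} {R : A → A → Set ℓ} {p q w} → AllPairs R w →
    precedes p q w ≡ true → R p q
  precedes-sorted {p = p} {q} {x ∷ w} (x≺w ∷ sorted) h with p ≟ x | mem q w in q∈w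
  ... | yes refl | true  = All.lookup x≺w (∈-mem w q∈w)
  ... | yes refl | false = precedes-sorted sorted h
  ... | no _     | _     = precedes-sorted sorted h

  precedes-sorted-false : ∀ {ℓ} {R : A → A → Set ℓ} {p q w} → AllPairs R w →
    ¬ R p q → precedes p q w ≡ false
  precedes-sorted-false {p = p} {q} {w} sorted ¬Rpq with precedes p q w in p≺q
  ... | true  = ⊥-elim (¬Rpq (precedes-sorted sorted p≺q))
  ... | false = refl

  precedes-∷ : ∀ {p q} x w → precedes p q w ≡ true → precedes p q (x ∷ w) ≡ true
  precedes-∷ {p} {q} x w h rewrite h = ∨-zeroʳ (does (p ≟ x) ∧ mem q w)

  precedes-total : ∀ {p q w} → ¬ p ≡ q → p ∈ w → q ∈ w →
    precedes p q w ≡ true ⊎ precedes q p w ≡ true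
  precedes-total p≢q (here refl) (here refl) = ⊥-elim (p≢q refl)
  precedes-total {p} p≢q (here refl) (there q∈w)
    rewrite dec-true (p ≟ p) refl | mem-∈ q∈w = inj₁ refl
  precedes-total {q = q} p≢q (there p∈w) (here refl)
    rewrite dec-true (q ≟ q) refl | mem-∈ p∈w = inj₂ refl
  precedes-total {w = x ∷ w} p≢q (there p∈w) (there q∈w) =
    Sum.map (precedes-∷ x w) (precedes-∷ x w) (precedes-total p≢q p∈w q∈w)

  precedes-sorted-complete : ∀ {ℓ} {R : A → A → Set ℓ} {p q w} → AllPairs R w →
    p ∈ w → q ∈ w → ¬ p ≡ q → ¬ R q p → precedes p q w ≡ true
  precedes-sorted-complete sorted p∈w q∈w p≢q ¬Rqp with precedes-total p≢q p∈w q∈w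
  ... | inj₁ p≺q = p≺q
  ... | inj₂ q≺p = ⊥-elim (¬Rqp (precedes-sorted sorted q≺p))

  disjoint : ∀ {z} B C → Unique {A = A} (B ++ C) → z ∈ B → z ∉ C
  disjoint (x ∷ B) C (x∉ ∷ _) (here refl) z∈C = All.lookup (++⁻ʳ B x∉) z∈C refl
  disjoint (x ∷ B) C (_ ∷ u)  (there z∈B) = disjoint B C u z∈B

  complement : ∀ {i} B C → Unique {A = A} (B ++ C) → i ∈ B ++ C → mem i C ≡ not (mem i B)
  complement B C u i∈ with ∈-++⁻ B i∈
  ... | inj₁ i∈B = trans (mem-∉ (disjoint B C u i∈B)) (cong not (sym (mem-∈ i∈B)))
  ... | inj₂ i∈C = trans (mem-∈ i∈C) (cong not (sym (mem-∉ (λ i∈B → disjoint B C u i∈B i∈C))))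

open Occurrences ℕ._≟_

ascents : ℕ → List ℕ → ℕ
ascents k w = count k (λ i → precedes i (suc i) w)

ascents-swap : ∀ k P a c S → suc a ≢ c → suc c ≢ a →
  ascents k (P ++ a ∷ c ∷ S) ≡ ascents k (P ++ c ∷ a ∷ S)
ascents-swap k P a c S a⋯c c⋯a = count-cong k λ i _ →
  precedes-swap i (suc i) P a c S
    (λ (i≡a , 1+i≡c) → a⋯c (trans (cong suc (sym i≡a)) 1+i≡c))
    (λ (i≡c , 1+i≡a) → c⋯a (trans (cong suc (sym i≡c)) 1+i≡a))

-- For a pair (i, i+1) whose letters each lie in exactly one of B, C: conjugating BC to CB
-- reverses the order of the pair exactly when it is split, i.e. at a switch of (mem · B).
rotate-pair : ∀ i B C → mem i C ≡ not (mem i B) → mem (suc i) C ≡ not (mem (suc i) B) →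
  bit (precedes i (suc i) (B ++ C)) + bit (not (mem i B) ∧ mem (suc i) B)
    ≡ bit (precedes i (suc i) (C ++ B)) + bit (mem i B ∧ not (mem (suc i) B))
rotate-pair i B C i∈C j∈C
  rewrite precedes-++ i (suc i) B C | precedes-++ i (suc i) C B | i∈C | j∈C
  with mem i B in i∈B | mem (suc i) B in j∈B
... | true  | true  rewrite precedes-absentˡ {q = suc i} C i∈C
                          | ∨-identityʳ (precedes i (suc i) B) = refl
... | false | false rewrite precedes-absentˡ {q = suc i} B i∈B
                          | ∨-identityʳ (precedes i (suc i) C) = refl
... | true  | false rewrite precedes-absentʳ {p = i} B j∈B
                          | precedes-absentˡ {q = suc i} C i∈C = refl
... | false | true  rewrite precedes-absentˡ {q = suc i} B i∈B
                          | precedes-absentʳ {p = i} C j∈C = refl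

ascents-rotate : ∀ k B C → (∀ i → i ≤ k → mem i C ≡ not (mem i B)) →
  ascents k (B ++ C) ≤ ascents k (C ++ B) + 1
ascents-rotate k B C split = +-cancelʳ-≤ (entries k) _ _ (begin
    ascents k (B ++ C) + entries k
      ≡⟨ count-exchange k (λ i i<k → rotate-pair i B C (split i (<⇒≤ i<k)) (split (suc i) i<k)) ⟩
    ascents k (C ++ B) + exits k
      ≤⟨ +-monoʳ-≤ (ascents k (C ++ B)) (exits≤entries+1 k) ⟩
    ascents k (C ++ B) + (entries k + 1)
      ≡⟨ cong (ascents k (C ++ B) +_) (+-comm (entries k) 1) ⟩
    ascents k (C ++ B) + (1 + entries k)
      ≡⟨ +-assoc (ascents k (C ++ B)) 1 (entries k) ⟨
    (ascents k (C ++ B) + 1) + entries k ∎)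
  where
    open ≤-Reasoning
    open Switches (λ i → mem i B)

unique-↭ : ∀ {A : Set} {xs ys : List A} → xs ↭ ys → Unique xs → Unique ys
unique-↭ {A} p = PermutationSetoid.Unique-resp-↭ (setoid A) (↭⇒↭ₛ p)

step-↭ : ∀ {n} {u w : Word n} → SylvStep u w → u ↭ w
step-↭ (rel x y v a b c _ _) = ++⁺ˡ x (++⁺ʳ y (swap c a ↭-refl))

≈s-↭ : ∀ {n} {u w : Word n} → u ≈s w → u ↭ w
≈s-↭ ≈-refl          = ↭-refl
≈s-↭ (≈-fwd s v≈w) = ↭-trans (step-↭ s) (≈s-↭ v≈w)
≈s-↭ (≈-bwd s v≈w) = ↭-trans (↭-sym (step-↭ s)) (≈s-↭ v≈w)

step-distinct : ∀ {A : Set} (x y v : List A) {a b c} →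
  Unique (x ++ (c ∷ a ∷ v ++ b ∷ []) ++ y) → a ≢ b
step-distinct []      y v (_ ∷ a∉ ∷ _) = All.lookup a∉ (∈-++⁺ˡ (∈-++⁺ʳ v (here refl)))
step-distinct (_ ∷ x) y v (_ ∷ u)      = step-distinct x y v u

-- A relation cavb → acvb with a < b < c swaps c and a, which are not consecutive.
ascents-step : ∀ {n} k {u w : Word n} → SylvStep u w → Unique u →
  ascents k (map toℕ u) ≡ ascents k (map toℕ w)
ascents-step k (rel x y v a b c a≤b b<c) u
  rewrite map-++ toℕ x (c ∷ a ∷ (v ++ b ∷ []) ++ y) | map-++ toℕ x (a ∷ c ∷ (v ++ b ∷ []) ++ y) =
  ascents-swap k (map toℕ x) (toℕ c) (toℕ a) (map toℕ ((v ++ b ∷ []) ++ y))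
    (λ 1+c≡a → <⇒≱ a<c (subst (toℕ c ≤_) 1+c≡a (n≤1+n (toℕ c))))
    (λ 1+a≡c → <⇒≱ b<c (subst (_≤ toℕ b) 1+a≡c a<b))
  where
    a<b : toℕ a < toℕ b
    a<b = ≤∧≢⇒< a≤b (λ a≡b → step-distinct x y v u (toℕ-injective a≡b))
    a<c : toℕ a < toℕ c
    a<c = <-trans a<b b<c

ascents-≈ : ∀ {n} k {u w : Word n} → u ≈s w → Unique u →
  ascents k (map toℕ u) ≡ ascents k (map toℕ w)
ascents-≈ k ≈-refl        _  = refl
ascents-≈ k (≈-fwd s v≈w) uu = trans (ascents-step k s uu) (ascents-≈ k v≈w (unique-↭ (step-↭ s) uu))
ascents-≈ k (≈-bwd s v≈w) uu = trans (sym (ascents-step k s vu)) (ascents-≈ k v≈w vu)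
  where vu = unique-↭ (↭-sym (step-↭ s)) uu

standard-unique : ∀ {n} {w : Word n} → Standard w → Unique w
standard-unique {n} std = unique-↭ (↭-sym std) (Unique.allFin⁺ n)

value∈ : ∀ {n} {w : Word n} {i} → Standard w → i < n → i ∈ map toℕ w
value∈ std i<n = subst (_∈ _) (toℕ-fromℕ< i<n) (∈-map⁺ toℕ (∈-resp-↭ (↭-sym std) (∈-allFin _)))

standard-complement : ∀ {n} (x y : Word n) → Standard (x ++ y) →
  ∀ i → i < n → mem i (map toℕ y) ≡ not (mem i (map toℕ x))
standard-complement x y std i i<n = complement (map toℕ x) (map toℕ y)
  (subst Unique (map-++ toℕ x y) (Unique.map⁺ toℕ-injective (standard-unique std)))
  (subst (i ∈_) (map-++ toℕ x y) (value∈ std i<n))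

asc : ∀ {m} → Word (suc m) → ℕ
asc {m} w = ascents m (map toℕ w)

edge-standard : ∀ {n} {s r : Word n} → Standard s → Edge s r → Standard r
edge-standard std (x , y , xy≈s , yx≈r) =
  ↭-trans (↭-sym (≈s-↭ yx≈r)) (↭-trans (++-comm y x) (↭-trans (≈s-↭ xy≈s) std))

edge-bound : ∀ {m} {s r : Word (suc m)} → Standard s → Edge s r → asc s ≤ asc r + 1
edge-bound {m} {s} {r} std (x , y , xy≈s , yx≈r) = begin
    asc s                                   ≡⟨ ascents-≈ m xy≈s (standard-unique xy-std) ⟨
    ascents m (map toℕ (x ++ y))            ≡⟨ cong (ascents m) (map-++ toℕ x y) ⟩
    ascents m (map toℕ x ++ map toℕ y)      ≤⟨ ascents-rotate m (map toℕ x) (map toℕ y)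
                                                (λ i i≤m → standard-complement x y xy-std i (s≤s i≤m)) ⟩
    ascents m (map toℕ y ++ map toℕ x) + 1  ≡⟨ cong (λ w → ascents m w + 1) (map-++ toℕ y x) ⟨
    ascents m (map toℕ (y ++ x)) + 1        ≡⟨ cong (_+ 1) (ascents-≈ m yx≈r (standard-unique yx-std)) ⟩
    asc r + 1                               ∎
  where
    open ≤-Reasoning
    xy-std = ↭-trans (≈s-↭ xy≈s) std
    yx-std = ↭-trans (++-comm y x) xy-std

walk-bound : ∀ {m k} {s t : Word (suc m)} → Standard s → Walk k s t → asc s ≤ asc t + k
walk-bound {m} {s = s} {t} std (here s≈t) = begin
    asc s      ≡⟨ ascents-≈ m s≈t (standard-unique std) ⟩
    asc t      ≡⟨ +-identityʳ (asc t) ⟨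
    asc t + 0  ∎
  where open ≤-Reasoning
walk-bound {k = suc k} {s} {t} std (step {r = r} e walk) = begin
    asc s              ≤⟨ edge-bound std e ⟩
    asc r + 1          ≤⟨ +-monoˡ-≤ 1 (walk-bound (edge-standard std e) walk) ⟩
    (asc t + k) + 1    ≡⟨ +-assoc (asc t) k 1 ⟩
    asc t + (k + 1)    ≡⟨ cong (asc t +_) (+-comm k 1) ⟩
    asc t + suc k      ∎
  where open ≤-Reasoning

increasing : ∀ n → AllPairs _<_ (map toℕ (allFin n))
increasing n = AllPairs.map⁺ (AllPairs.tabulate⁺-< (λ i<j → i<j))

asc-identity : ∀ m → asc (allFin (suc m)) ≡ m
asc-identity m = count-all m λ i i<m →
  precedes-sorted-complete (increasing (suc m))
    (value∈ ↭-refl (m<n⇒m<1+n i<m)) (value∈ ↭-refl (s≤s i<m))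
    (λ i≡1+i → <-irrefl i≡1+i (n<1+n i)) (<-asym (n<1+n i))

asc-reverse : ∀ m → asc (reverse (allFin (suc m))) ≡ 0
asc-reverse m = count-none m λ i _ → begin
    precedes i (suc i) (map toℕ (reverse (allFin (suc m))))
      ≡⟨ cong (precedes i (suc i)) (reverse-map toℕ (allFin (suc m))) ⟩
    precedes i (suc i) (reverse (map toℕ (allFin (suc m))))
      ≡⟨ precedes-reverse i (suc i) (map toℕ (allFin (suc m))) ⟩
    precedes (suc i) i (map toℕ (allFin (suc m)))
      ≡⟨ precedes-sorted-false (increasing (suc m)) (<-asym (n<1+n i)) ⟩
    false ∎
  where open ≡-Reasoning

proposition3p3 : (n : ℕ) → 1 ≤ n →
    Σ (Word n) λ u → Σ (Word n) λ v →
      Standard u × Standard v × ((k : ℕ) → Walk k u v → n ∸ 1 ≤ k)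
proposition3p3 (suc m) _ =
  allFin (suc m) , reverse (allFin (suc m)) , ↭-refl , ↭-reverse (allFin (suc m)) ,
  λ k walk → begin
    m                                    ≡⟨ asc-identity m ⟨
    asc (allFin (suc m))                 ≤⟨ walk-bound ↭-refl walk ⟩
    asc (reverse (allFin (suc m))) + k   ≡⟨ cong (_+ k) (asc-reverse m) ⟩
    k                                    ∎
  where open ≤-Reasoning
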